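{- There exists a streaming certification scheme for $\mathrm{MaxMatching}_{\geq}$ such that, on $n$-node graphs with maximum degree $\Delta\geq 2$, the certificate size is $O(n\log\Delta)$ bits and the verifier's space complexity is $O(n)$ bits.
   Context: Inputs are an $n$-node graph $G$ on vertex set $[n]$ together with an integer threshold $k$; the threshold $k$ is given first, and then the edges of $G$ arrive as a stream in an arbitrary, possibly adversarial, order. A streaming certification scheme for a decision problem $P$ consists of a prover and a verifier. The prover is a computationally unlimited function which, for each input, produces a certificate $c\in\{0,1\}^*$ depending only on the input (not on the order of the edges). The verifier is a deterministic streaming algorithm with read-only access to $c$ that processes the edge stream and outputs accept or reject at the end. Completeness: if the input satisfies $P$, there is a certificate $c$ such that for every edge order the verifier accepts. Soundness: if the input does not satisfy $P$, then for every certificate $c$ and every edge order the verifier rejects. The verifier's space complexity excludes the read-only certificate. $\mathrm{MaxMatching}_{\geq}$ asks whether the maximum matching of $G$ has size at least $k$. -}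

module Defs where

open import Data.Bool using (Bool; true; false; _∧_; _∨_)
open import Data.Nat using (ℕ; zero; suc; _⊔_)
open import Data.Fin using (Fin; _≟_)
open import Data.Product using (_×_; _,_; Σ; ∃)
open import Data.List using (List; []; _∷_; length; filter; map; foldr; foldl; allFin; concatMap)
open import Data.List.Relation.Unary.All using (All)
open import Data.List.Relation.Unary.Unique.Propositional using (Unique)
open import Data.Vec using (Vec)
open import Relation.Nullary.Decidable using (⌊_⌋)
open import Relation.Binary.PropositionalEquality using (_≡_)
open import Data.Nat using (_≤_)

record Graph (n : ℕ) : Set where
  field
    adj   : Fin n → Fin n → Bool
    sym   : ∀ u v → adj u v ≡ adj v u
    irrefl : ∀ v → adj v v ≡ false
open Graph public

Edge : ℕ → Set
Edge n = Fin n × Fin n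

countB : ∀ {A : Set} → (A → Bool) → List A → ℕ
countB p [] = 0
countB p (x ∷ xs) with p x
... | true  = suc (countB p xs)
... | false = countB p xs

deg : ∀ {n} → Graph n → Fin n → ℕ
deg {n} G v = countB (adj G v) (allFin n)

maxDeg : ∀ {n} → Graph n → ℕ
maxDeg {n} G = foldr _⊔_ 0 (map (deg G) (allFin n))

endpoints : ∀ {n} → List (Edge n) → List (Fin n)
endpoints = concatMap (λ { (u , v) → u ∷ v ∷ [] })

IsMatching : ∀ {n} → Graph n → List (Edge n) → Set
IsMatching G M = All (λ { (u , v) → adj G u v ≡ true }) M × Unique (endpoints M)

MaxMatchingGE : ∀ {n} → Graph n → ℕ → Set
MaxMatchingGE G k = Σ (List _) λ M → IsMatching G M × k ≤ length M

isPair : ∀ {n} → Fin n → Fin n → Edge n → Bool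
isPair u v (a , b) = (⌊ a ≟ u ⌋ ∧ ⌊ b ≟ v ⌋) ∨ (⌊ a ≟ v ⌋ ∧ ⌊ b ≟ u ⌋)

ValidStream : ∀ {n} → Graph n → List (Edge n) → Set
ValidStream G s =
  All (λ { (u , v) → adj G u v ≡ true }) s ×
  (∀ u v → adj G u v ≡ true → countB (isPair u v) s ≡ 1)

Certificate : Set
Certificate = List Bool

-- A deterministic streaming verifier with read-only access to the certificate.
-- Its working memory on n-node inputs is exactly  space n  bits; the
-- certificate is not counted.
record Verifier : Set where
  field
    space : ℕ → ℕ
    init  : (n k : ℕ) → Certificate → Vec Bool (space n)
    step  : (n k : ℕ) → Certificate → Vec Bool (space n) → Edge n → Vec Bool (space n)
    final : (n k : ℕ) → Certificate → Vec Bool (space n) → Bool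
open Verifier public

run : Verifier → (n k : ℕ) → Certificate → List (Edge n) → Bool
run V n k c s = final V n k c (foldl (step V n k c) (init V n k c) s)

-- Prover: any function of the input (not of the edge order).
Prover : Set
Prover = (n k : ℕ) → Graph n → Certificate

-- The certificate gives every vertex a bit (is it matched?) and a label of ⌈log₂ Δ⌉ + 2 bits;
-- a stream edge is marked when both endpoints are matched and carry the same label. The verifier keeps
-- two bits per vertex, recording whether it has met a marked edge at least once and at least twice, and
-- accepts when no vertex meets two marked edges, every matched vertex meets one, and at least 2k vertices
-- are matched: whatever the certificate, the marked edges then form a matching of size at least k.
-- Conversely, given a matching M, colour the vertices so that mates share a colour and adjacent non-mates
-- do not; greedily colouring the graph with mates contracted needs at most 2Δ + 1 colours, and with these
-- colours as labels the marked edges are exactly M. The prover finds such a certificate by exhaustive search.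

module Submission where

open import Defs hiding (sym)
open import Data.Bool using (Bool; true; false; _∧_; _∨_; not; if_then_else_)
import Data.Bool as Bool
open import Data.Bool.Properties using (∧-conicalˡ; ∧-conicalʳ; ∨-zeroʳ; T-≡)
open import Data.Fin using (Fin; zero; suc; _≟_; toℕ)
open import Data.Fin.Properties using (all?; any?)
open import Data.List using (List; []; _∷_; length; _++_; take; drop; replicate; concat; tabulate; foldl; filter; allFin; map)
open import Data.List.Properties using (∷-injective; ≡-dec; length-++; length-replicate; filter-notAll; foldr-preservesᵒ)
open import Data.List.Membership.Propositional using (_∈_; _∉_)
open import Data.List.Membership.Propositional.Properties using (∈-filter⁺; ∈-allFin; ∈-map⁺)
open import Data.List.Relation.Unary.All using (All; []; _∷_)
open import Data.List.Relation.Unary.All.Properties using (filter⁺)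
open import Data.List.Relation.Unary.AllPairs using ([]; _∷_)
open import Data.List.Relation.Unary.Any using (here; there)
import Data.List.Relation.Unary.Any as Any
open import Data.List.Relation.Unary.Unique.Propositional using (Unique)
open import Data.Maybe using (Maybe; just; nothing)
open import Data.Maybe.Properties using (just-injective)
open import Data.Nat using (ℕ; zero; suc; _+_; _*_; _^_; _≤_; _<_; _≤?_; z≤n; s≤s; ⌊_/2⌋; ⌈_/2⌉)
open import Data.Nat.Induction using (<-wellFounded)
open import Data.Nat.Logarithm using (⌈log₂_⌉; ⌈log₂⌉-mono-≤)
open import Data.Nat.Logarithm.Core using (⌈log2⌉)
open import Data.Nat.Properties
  using (+-assoc; +-comm; +-identityʳ; +-suc; *-distribˡ-+; ≤-refl; ≤-trans; ≤-reflexive; ≤-pred; ≤-<-trans; <⇒≱;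
         n≤0⇒n≡0; n≤1+n; m≤n⇒m≤1+n; m≤m+n; m≤n+m; m≤m⊔n; m≤n⊔m; m<m+n; m^n>0; suc-injective;
         +-mono-≤; +-monoˡ-≤; +-monoʳ-≤; *-mono-≤; *-monoʳ-≤; *-monoʳ-<; *-cancelˡ-≤; *-cancelˡ-<;
         ⌊n/2⌋+⌈n/2⌉≡n; ⌊n/2⌋≤⌈n/2⌉; ⌈n/2⌉<n; module ≤-Reasoning)
import Data.Nat.Properties as ℕ
open import Algebra.Properties.CommutativeMonoid.Sum ℕ.+-0-commutativeMonoid
  using (sum; sum-cong-≗; ∑-distrib-+; sum-replicate-zero)
open import Data.List.Membership.DecPropositional ℕ._≟_ using (_∈?_)
open import Data.Nat.Tactic.RingSolver using (solve-∀)
open import Data.Product using (Σ; ∃-syntax; _×_; _,_; proj₁; proj₂; map₁)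
open import Data.Sum using (_⊎_; inj₁; inj₂; [_,_])
open import Data.Vec using (Vec; lookup; _[_]≔_) renaming ([] to []ᵛ; _∷_ to _∷ᵛ_; _++_ to _++ᵛ_; replicate to replicateᵛ)
open import Data.Vec.Properties using (lookup∘update; lookup∘update′; lookup-replicate)
open import Function using (_∘_; flip; Equivalence)
open import Induction.WellFounded using (Acc; acc)
open import Relation.Nullary using (Dec; yes; no; does; ¬_; ¬?; contradiction)
open import Relation.Nullary.Decidable using (⌊_⌋; _×-dec_; _⊎-dec_; _→-dec_; map′; toWitness; dec-true)
open import Relation.Unary using (Decidable)
open import Relation.Binary.PropositionalEquality using (_≡_; _≢_; refl; sym; trans; cong; cong₂; subst; module ≡-Reasoning)

bit : Bool → ℕ
bit b = if b then 1 else 0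

sum-mono-≤ : ∀ {n} {f g : Fin n → ℕ} → (∀ i → f i ≤ g i) → sum f ≤ sum g
sum-mono-≤ {zero} h = z≤n
sum-mono-≤ {suc n} h = +-mono-≤ (h zero) (sum-mono-≤ (λ i → h (suc i)))

countB-∷ : ∀ {A : Set} (p : A → Bool) x xs → countB p (x ∷ xs) ≡ bit (p x) + countB p xs
countB-∷ p x xs with p x
... | true = refl
... | false = refl

⌊≟⌋-refl : ∀ {n} (x : Fin n) → ⌊ x ≟ x ⌋ ≡ true
⌊≟⌋-refl x with x ≟ x
... | yes _ = refl
... | no x≢x = contradiction refl x≢x

δ : ∀ {n} → Fin n → Fin n → ℕ
δ x v = bit ⌊ x ≟ v ⌋

sum-δ : ∀ {n} (x : Fin n) → sum (δ x) ≡ 1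
sum-δ {suc n} zero = cong suc (sum-replicate-zero n)
sum-δ {suc n} (suc x) = trans (sum-cong-≗ δ-suc) (sum-δ x)
  where
  δ-suc : ∀ i → δ (suc x) (suc i) ≡ δ x i
  δ-suc i with x ≟ i
  ... | yes _ = refl
  ... | no _ = refl

occ : ∀ {n} → Fin n → List (Fin n) → ℕ
occ v = countB (λ x → ⌊ x ≟ v ⌋)

occ-∷ : ∀ {n} (v x : Fin n) xs → occ v (x ∷ xs) ≡ δ x v + occ v xs
occ-∷ v = countB-∷ (λ y → ⌊ y ≟ v ⌋)

occ-here : ∀ {n} (x : Fin n) xs → occ x (x ∷ xs) ≡ suc (occ x xs)
occ-here x xs = trans (occ-∷ x x xs) (cong (λ b → bit b + occ x xs) (⌊≟⌋-refl x))

occ-there : ∀ {n} {v x : Fin n} xs → x ≢ v → occ v (x ∷ xs) ≡ occ v xs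
occ-there {v = v} {x} xs x≢v with x ≟ v
... | yes x≡v = contradiction x≡v x≢v
... | no _ = refl

occ-++ : ∀ {n} (v : Fin n) xs ys → occ v (xs ++ ys) ≡ occ v xs + occ v ys
occ-++ v [] ys = refl
occ-++ v (x ∷ xs) ys = begin
  occ v (x ∷ xs ++ ys)          ≡⟨ occ-∷ v x (xs ++ ys) ⟩
  δ x v + occ v (xs ++ ys)      ≡⟨ cong (δ x v +_) (occ-++ v xs ys) ⟩
  δ x v + (occ v xs + occ v ys) ≡⟨ +-assoc (δ x v) _ _ ⟨
  (δ x v + occ v xs) + occ v ys ≡⟨ cong (_+ occ v ys) (occ-∷ v x xs) ⟨
  occ v (x ∷ xs) + occ v ys     ∎
  where open ≡-Reasoning

sum-occ : ∀ {n} (xs : List (Fin n)) → sum (λ v → occ v xs) ≡ length xs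
sum-occ {n} [] = sum-replicate-zero n
sum-occ (x ∷ xs) = begin
  sum (λ v → occ v (x ∷ xs))           ≡⟨ sum-cong-≗ (λ v → occ-∷ v x xs) ⟩
  sum (λ v → δ x v + occ v xs)         ≡⟨ ∑-distrib-+ (δ x) (λ v → occ v xs) ⟩
  sum (δ x) + sum (λ v → occ v xs)     ≡⟨ cong₂ _+_ (sum-δ x) (sum-occ xs) ⟩
  suc (length xs)                      ∎
  where open ≡-Reasoning

occ≡0⇒All≢ : ∀ {n} (v : Fin n) xs → occ v xs ≡ 0 → All (v ≢_) xs
occ≡0⇒All≢ v [] _ = []
occ≡0⇒All≢ v (x ∷ xs) h with x ≟ v
... | no x≢v = (λ v≡x → x≢v (sym v≡x)) ∷ occ≡0⇒All≢ v xs h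

All≢⇒occ≡0 : ∀ {n} (v : Fin n) xs → All (v ≢_) xs → occ v xs ≡ 0
All≢⇒occ≡0 v [] [] = refl
All≢⇒occ≡0 v (x ∷ xs) (v≢x ∷ h) with x ≟ v
... | yes x≡v = contradiction (sym x≡v) v≢x
... | no _ = All≢⇒occ≡0 v xs h

occ≤1⇒Unique : ∀ {n} (xs : List (Fin n)) → (∀ v → occ v xs ≤ 1) → Unique xs
occ≤1⇒Unique [] _ = []
occ≤1⇒Unique (x ∷ xs) h = occ≡0⇒All≢ x xs x∉xs ∷ occ≤1⇒Unique xs (λ v → ≤-trans (tail≤ v) (h v))
  where
  tail≤ : ∀ v → occ v xs ≤ occ v (x ∷ xs)
  tail≤ v = subst (occ v xs ≤_) (sym (occ-∷ v x xs)) (m≤n+m _ (δ x v))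
  x∉xs : occ x xs ≡ 0
  x∉xs = n≤0⇒n≡0 (≤-pred (subst (_≤ 1) (occ-here x xs) (h x)))

lsb : ℕ → Bool
lsb zero = false
lsb (suc zero) = true
lsb (suc (suc x)) = lsb x

lsb+2*half : ∀ x → x ≡ bit (lsb x) + 2 * ⌊ x /2⌋
lsb+2*half zero = refl
lsb+2*half (suc zero) = refl
lsb+2*half (suc (suc x)) = begin
  2 + x                                ≡⟨ cong (2 +_) (lsb+2*half x) ⟩
  2 + (bit (lsb x) + 2 * ⌊ x /2⌋)      ≡⟨ +-comm 2 _ ⟩
  (bit (lsb x) + 2 * ⌊ x /2⌋) + 2      ≡⟨ +-assoc (bit (lsb x)) _ 2 ⟩
  bit (lsb x) + (2 * ⌊ x /2⌋ + 2)      ≡⟨ cong (bit (lsb x) +_) (+-comm (2 * ⌊ x /2⌋) 2) ⟩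
  bit (lsb x) + (2 + 2 * ⌊ x /2⌋)      ≡⟨ cong (bit (lsb x) +_) (*-distribˡ-+ 2 1 ⌊ x /2⌋) ⟨
  bit (lsb x) + 2 * suc ⌊ x /2⌋        ∎
  where open ≡-Reasoning

bits : ℕ → ℕ → List Bool
bits zero x = []
bits (suc w) x = lsb x ∷ bits w ⌊ x /2⌋

length-bits : ∀ w x → length (bits w x) ≡ w
length-bits zero x = refl
length-bits (suc w) x = cong suc (length-bits w ⌊ x /2⌋)

half<2^ : ∀ w x → x < 2 ^ suc w → ⌊ x /2⌋ < 2 ^ w
half<2^ w x x<2^suc = *-cancelˡ-< 2 _ _ (begin-strict
  2 * ⌊ x /2⌋                  ≤⟨ m≤n+m _ (bit (lsb x)) ⟩
  bit (lsb x) + 2 * ⌊ x /2⌋    ≡⟨ lsb+2*half x ⟨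
  x                            <⟨ x<2^suc ⟩
  2 * 2 ^ w                    ∎)
  where open ≤-Reasoning

bits-injective : ∀ w {x y} → x < 2 ^ w → y < 2 ^ w → bits w x ≡ bits w y → x ≡ y
bits-injective zero {zero} {zero} _ _ _ = refl
bits-injective zero {suc x} (s≤s ()) _ _
bits-injective zero {zero} {suc y} _ (s≤s ()) _
bits-injective (suc w) {x} {y} x< y< eq with ∷-injective eq
... | lsb≡ , rest≡ = begin
  x                            ≡⟨ lsb+2*half x ⟩
  bit (lsb x) + 2 * ⌊ x /2⌋    ≡⟨ cong₂ (λ b h → bit b + 2 * h) lsb≡ half≡ ⟩
  bit (lsb y) + 2 * ⌊ y /2⌋    ≡⟨ lsb+2*half y ⟨
  y                            ∎
  where
  open ≡-Reasoning
  half≡ : ⌊ x /2⌋ ≡ ⌊ y /2⌋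
  half≡ = bits-injective w (half<2^ w x x<) (half<2^ w y y<) rest≡

n≤2^⌈log₂n⌉ : ∀ n → n ≤ 2 ^ ⌈log₂ n ⌉
n≤2^⌈log₂n⌉ n = go n (<-wellFounded n)
  where
  go : ∀ n (rec : Acc _<_ n) → n ≤ 2 ^ ⌈log2⌉ n rec
  go zero _ = z≤n
  go (suc zero) _ = s≤s z≤n
  go (suc (suc n)) (acc rs) = begin
    2 + n                       ≡⟨ cong (2 +_) (⌊n/2⌋+⌈n/2⌉≡n n) ⟨
    2 + (⌊ n /2⌋ + ⌈ n /2⌉)     ≤⟨ s≤s (s≤s (+-monoˡ-≤ ⌈ n /2⌉ (⌊n/2⌋≤⌈n/2⌉ n))) ⟩
    2 + (⌈ n /2⌉ + ⌈ n /2⌉)     ≡⟨ cong suc (+-suc ⌈ n /2⌉ ⌈ n /2⌉) ⟨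
    suc ⌈ n /2⌉ + suc ⌈ n /2⌉   ≤⟨ +-mono-≤ ih (≤-trans ih (m≤m+n _ 0)) ⟩
    2 * 2 ^ ⌈log2⌉ (suc ⌈ n /2⌉) _ ∎
    where
    open ≤-Reasoning
    ih = go (suc ⌈ n /2⌉) (rs (⌈n/2⌉<n n))

splitHeader : Certificate → ℕ × List Bool
splitHeader [] = 0 , []
splitHeader (true ∷ c) = map₁ suc (splitHeader c)
splitHeader (false ∷ c) = 0 , c

chunk : ℕ → ℕ → List Bool → List Bool
chunk w zero xs = take w xs
chunk w (suc i) xs = chunk w i (drop w xs)

-- A certificate 1^W 0 b₀ b₁ … consists of blocks bᵢ of W + 1 bits each.
block : Certificate → ℕ → List Bool
block c i with splitHeader c
... | W , body = chunk (suc W) i body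

encode : ℕ → ∀ n → (Fin n → List Bool) → Certificate
encode W n f = replicate W true ++ false ∷ concat (tabulate f)

splitHeader-encode : ∀ W body → splitHeader (replicate W true ++ false ∷ body) ≡ (W , body)
splitHeader-encode zero body = refl
splitHeader-encode (suc W) body rewrite splitHeader-encode W body = refl

take-++ : ∀ {w} xs (ys : List Bool) → length xs ≡ w → take w (xs ++ ys) ≡ xs
take-++ [] ys refl = refl
take-++ (x ∷ xs) ys refl = cong (x ∷_) (take-++ xs ys refl)

drop-++ : ∀ {w} xs (ys : List Bool) → length xs ≡ w → drop w (xs ++ ys) ≡ ys
drop-++ [] ys refl = refl
drop-++ (x ∷ xs) ys refl = drop-++ xs ys refl

chunk-concat : ∀ {w n} (f : Fin n → List Bool) → (∀ i → length (f i) ≡ w) → ∀ i → chunk w (toℕ i) (concat (tabulate f)) ≡ f i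
chunk-concat f len zero = take-++ (f zero) _ (len zero)
chunk-concat f len (suc i) rewrite drop-++ (f zero) (concat (tabulate (λ j → f (suc j)))) (len zero) =
  chunk-concat (λ j → f (suc j)) (λ j → len (suc j)) i

length-concat : ∀ {w n} (f : Fin n → List Bool) → (∀ i → length (f i) ≡ w) → length (concat (tabulate f)) ≡ n * w
length-concat {n = zero} f len = refl
length-concat {n = suc n} f len = trans (length-++ (f zero)) (cong₂ _+_ (len zero) (length-concat (λ j → f (suc j)) (λ j → len (suc j))))

module _ {W n} (f : Fin n → List Bool) (len : ∀ i → length (f i) ≡ suc W) where

  block-encode : ∀ i → block (encode W n f) (toℕ i) ≡ f i
  block-encode i rewrite splitHeader-encode W (concat (tabulate f)) = chunk-concat f len i

  length-encode : length (encode W n f) ≡ suc n * suc W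
  length-encode = trans (length-++ (replicate W true))
    (trans (cong₂ _+_ (length-replicate W) (cong suc (length-concat f len))) (+-suc W (n * suc W)))

headBit : List Bool → Bool
headBit [] = false
headBit (b ∷ _) = b

module _ {n : ℕ} (c : Certificate) where

  matched : Fin n → Bool
  matched v = headBit (block c (toℕ v))

  label : Fin n → List Bool
  label v = drop 1 (block c (toℕ v))

  Marked : Edge n → Set
  Marked (a , b) = matched a ≡ true × matched b ≡ true × label a ≡ label b

  -- Opaque so that `with marked? c e` can abstract the decision made inside `filter` and `process`.
  opaque
    marked? : Decidable Marked
    marked? (a , b) = (matched a Bool.≟ true) ×-dec ((matched b Bool.≟ true) ×-dec ≡-dec Bool._≟_ (label a) (label b))

  matchedCount : ℕ
  matchedCount = sum (λ v → bit (matched v))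

Marked-swap : ∀ {n} c {a b : Fin n} → Marked c (a , b) → Marked c (b , a)
Marked-swap c (ma , mb , la≡lb) = mb , ma , sym la≡lb

State : ℕ → Set
State n = Vec Bool n × Vec Bool n

initial : ∀ n → State n
initial n = replicateᵛ n false , replicateᵛ n false

visit : ∀ {n} → Fin n → State n → State n
visit x (once , twice) = once [ x ]≔ true , twice [ x ]≔ (lookup twice x ∨ lookup once x)

process : ∀ {n} → Certificate → State n → Edge n → State n
process c st (a , b) = if does (marked? c (a , b)) then visit b (visit a st) else st

Accepts : ∀ {n} → Certificate → ℕ → State n → Set
Accepts {n} c k (once , twice) =
  (∀ v → lookup twice v ≡ false) × (∀ v → matched c v ≡ true → lookup once v ≡ true) × 2 * k ≤ matchedCount {n} c

accepts? : ∀ {n} c k (st : State n) → Dec (Accepts c k st)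
accepts? {n} c k (once , twice) =
  all? (λ v → lookup twice v Bool.≟ false) ×-dec
  (all? (λ v → (matched c v Bool.≟ true) →-dec (lookup once v Bool.≟ true)) ×-dec
  (2 * k ≤? matchedCount {n} c))

splitᵛ : ∀ m {n} → Vec Bool (m + n) → Vec Bool m × Vec Bool n
splitᵛ zero v = []ᵛ , v
splitᵛ (suc m) (x ∷ᵛ v) = x ∷ᵛ proj₁ (splitᵛ m v) , proj₂ (splitᵛ m v)

splitᵛ-++ : ∀ {m n} (xs : Vec Bool m) (ys : Vec Bool n) → splitᵛ m (xs ++ᵛ ys) ≡ (xs , ys)
splitᵛ-++ []ᵛ ys = refl
splitᵛ-++ (x ∷ᵛ xs) ys rewrite splitᵛ-++ xs ys = refl

pack : ∀ {n} → State n → Vec Bool (n + n)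
pack (once , twice) = once ++ᵛ twice

verifier : Verifier
verifier = record
  { space = λ n → n + n
  ; init  = λ n _ _ → pack (initial n)
  ; step  = λ n _ c v e → pack (process c (splitᵛ n v) e)
  ; final = λ n k c v → does (accepts? c k (splitᵛ n v))
  }

run-verifier : ∀ n k c s → run verifier n k c s ≡ does (accepts? c k (foldl (process c) (initial n) s))
run-verifier n k c s = go (initial n) s
  where
  go : ∀ st s → final verifier n k c (foldl (step verifier n k c) (pack st) s) ≡ does (accepts? c k (foldl (process c) st s))
  go (once , twice) [] rewrite splitᵛ-++ once twice = refl
  go (once , twice) (e ∷ s) rewrite splitᵛ-++ once twice = go (process c (once , twice) e) s

atLeastOnce : ℕ → Bool
atLeastOnce zero = false
atLeastOnce (suc _) = true

atLeastTwice : ℕ → Bool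
atLeastTwice (suc (suc _)) = true
atLeastTwice _ = false

Tracks : ∀ {n} → State n → (Fin n → ℕ) → Set
Tracks (once , twice) d = ∀ v → lookup once v ≡ atLeastOnce (d v) × lookup twice v ≡ atLeastTwice (d v)

Tracks-cong : ∀ {n} (st : State n) {d d′} → (∀ v → d v ≡ d′ v) → Tracks st d → Tracks st d′
Tracks-cong (once , twice) d≗d′ t v rewrite sym (d≗d′ v) = t v

atLeastTwice-suc : ∀ m → (atLeastTwice m ∨ atLeastOnce m) ≡ atLeastTwice (suc m)
atLeastTwice-suc zero = refl
atLeastTwice-suc (suc zero) = refl
atLeastTwice-suc (suc (suc m)) = refl

visit-tracks : ∀ {n} (x : Fin n) st {d} → Tracks st d → Tracks (visit x st) (λ v → δ x v + d v)
visit-tracks x (once , twice) {d} t v with x ≟ v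
... | yes refl = lookup∘update x once true ,
                 trans (lookup∘update x twice _) (trans (cong₂ _∨_ (proj₂ (t x)) (proj₁ (t x))) (atLeastTwice-suc (d x)))
... | no x≢v = trans (lookup∘update′ (x≢v ∘ sym) once true) (proj₁ (t v)) ,
               trans (lookup∘update′ (x≢v ∘ sym) twice _) (proj₂ (t v))

module _ {n : ℕ} (c : Certificate) where

  markedDegree : List (Edge n) → Fin n → ℕ
  markedDegree s v = occ v (endpoints (filter (marked? c) s))

  markedDegree-∷ : ∀ e s v → markedDegree (e ∷ s) v ≡ markedDegree (e ∷ []) v + markedDegree s v
  markedDegree-∷ e s v with does (marked? c e)
  ... | true = occ-++ v (endpoints (e ∷ [])) _
  ... | false = refl

  process-tracks : ∀ st d e → Tracks st d → Tracks (process c st e) (λ v → d v + markedDegree (e ∷ []) v)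
  process-tracks st d (a , b) t with marked? c (a , b)
  ... | yes _ = Tracks-cong (visit b (visit a st)) reorder (visit-tracks b (visit a st) (visit-tracks a st t))
    where
    reorder : ∀ v → δ b v + (δ a v + d v) ≡ d v + occ v (a ∷ b ∷ [])
    reorder v rewrite occ-∷ v a (b ∷ []) | occ-∷ v b [] | +-identityʳ (δ b v)
      | sym (+-assoc (δ b v) (δ a v) (d v)) | +-comm (δ b v) (δ a v) = +-comm _ (d v)
  ... | no _ = Tracks-cong st (λ v → sym (+-identityʳ (d v))) t

  foldl-tracks : ∀ s st d → Tracks st d → Tracks (foldl (process c) st s) (λ v → d v + markedDegree s v)
  foldl-tracks [] st d t = Tracks-cong st (λ v → sym (+-identityʳ (d v))) t
  foldl-tracks (e ∷ s) st d t =
    Tracks-cong (foldl (process c) (process c st e) s)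
      (λ v → trans (+-assoc (d v) _ _) (cong (d v +_) (sym (markedDegree-∷ e s v))))
      (foldl-tracks s (process c st e) _ (process-tracks st d e t))

  run-tracks : ∀ s → Tracks (foldl (process c) (initial n) s) (markedDegree s)
  run-tracks s = foldl-tracks s (initial n) (λ _ → 0) (λ v → lookup-replicate v false , lookup-replicate v false)

does-true⁻ : ∀ {P : Set} (p? : Dec P) → does p? ≡ true → P
does-true⁻ (yes p) _ = p

length-endpoints : ∀ {n} (M : List (Edge n)) → length (endpoints M) ≡ 2 * length M
length-endpoints [] = refl
length-endpoints (_ ∷ M) rewrite length-endpoints M | +-identityʳ (length M) = cong suc (sym (+-suc (length M) (length M)))

atLeastTwice≡false⇒≤1 : ∀ m → atLeastTwice m ≡ false → m ≤ 1
atLeastTwice≡false⇒≤1 zero _ = z≤n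
atLeastTwice≡false⇒≤1 (suc zero) _ = s≤s z≤n

atLeastOnce≡true⇒≥1 : ∀ m → atLeastOnce m ≡ true → 1 ≤ m
atLeastOnce≡true⇒≥1 (suc m) _ = s≤s z≤n

EdgesOf : ∀ {n} → Graph n → List (Edge n) → Set
EdgesOf G = All (λ { (u , v) → adj G u v ≡ true })

module _ {n} (G : Graph n) (c : Certificate) where

  accepting⇒maxMatching : ∀ {k} s (st : State n) → EdgesOf G s → Tracks st (markedDegree c s) → Accepts c k st → MaxMatchingGE G k
  accepting⇒maxMatching {k} s (once , twice) edges tracks (noTwice , covered , 2k≤) =
    M , (filter⁺ (marked? c) edges , occ≤1⇒Unique E occ≤1) , *-cancelˡ-≤ 2 2k≤2|M|
    where
    M = filter (marked? c) s
    E = endpoints M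
    occ≤1 : ∀ v → occ v E ≤ 1
    occ≤1 v = atLeastTwice≡false⇒≤1 _ (trans (sym (proj₂ (tracks v))) (noTwice v))
    matched≤occ : ∀ v → bit (matched c v) ≤ occ v E
    matched≤occ v with matched c v in m
    ... | true = atLeastOnce≡true⇒≥1 _ (trans (sym (proj₁ (tracks v))) (covered v m))
    ... | false = z≤n
    2k≤2|M| : 2 * k ≤ 2 * length M
    2k≤2|M| = ≤-trans 2k≤ (≤-trans (sum-mono-≤ matched≤occ) (≤-reflexive (trans (sum-occ E) (length-endpoints M))))

soundness : ∀ n k (G : Graph n) c s → ValidStream G s → run verifier n k c s ≡ true → MaxMatchingGE G k
soundness n k G c s (edges , _) accepted =
  accepting⇒maxMatching G c s st edges (run-tracks c s) (does-true⁻ (accepts? c k st) (trans (sym (run-verifier n k c s)) accepted))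
  where st = foldl (process c) (initial n) s

⌊≟⌋-true⁻ : ∀ {n} {x y : Fin n} → ⌊ x ≟ y ⌋ ≡ true → x ≡ y
⌊≟⌋-true⁻ h = toWitness (Equivalence.from T-≡ h)

∨-true⁻ : ∀ x {y} → x ∨ y ≡ true → x ≡ true ⊎ y ≡ true
∨-true⁻ true _ = inj₁ refl
∨-true⁻ false h = inj₂ h

isPair-refl : ∀ {n} (u w : Fin n) → isPair u w (u , w) ≡ true
isPair-refl u w rewrite ⌊≟⌋-refl u | ⌊≟⌋-refl w = refl

isPair-swap : ∀ {n} (u w : Fin n) → isPair u w (w , u) ≡ true
isPair-swap u w rewrite ⌊≟⌋-refl u | ⌊≟⌋-refl w = ∨-zeroʳ _

isPair-true⁻ : ∀ {n} {u w : Fin n} e → isPair u w e ≡ true → e ≡ (u , w) ⊎ e ≡ (w , u)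
isPair-true⁻ {u = u} {w} (a , b) h with ∨-true⁻ (⌊ a ≟ u ⌋ ∧ ⌊ b ≟ w ⌋) h
... | inj₁ h₁ = inj₁ (cong₂ _,_ (⌊≟⌋-true⁻ (∧-conicalˡ _ _ h₁)) (⌊≟⌋-true⁻ (∧-conicalʳ _ _ h₁)))
... | inj₂ h₂ = inj₂ (cong₂ _,_ (⌊≟⌋-true⁻ (∧-conicalˡ _ _ h₂)) (⌊≟⌋-true⁻ (∧-conicalʳ _ _ h₂)))

module _ {n} (G : Graph n) (c : Certificate) where

  UniqueMarkedNeighbour : Fin n → Fin n → Set
  UniqueMarkedNeighbour v w =
    adj G v w ≡ true × Marked c (v , w) × (∀ u → adj G v u ≡ true → Marked c (v , u) → u ≡ w)

  uniqueMarkedNeighbour? : ∀ v w → Dec (UniqueMarkedNeighbour v w)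
  uniqueMarkedNeighbour? v w =
    (adj G v w Bool.≟ true) ×-dec (marked? c (v , w) ×-dec
      all? (λ u → (adj G v u Bool.≟ true) →-dec (marked? c (v , u) →-dec (u ≟ w))))

  adj-irrefl : ∀ {v w} → adj G v w ≡ true → w ≢ v
  adj-irrefl {v} a refl with () ← trans (sym a) (irrefl G v)

  module _ {v w : Fin n} (unique : UniqueMarkedNeighbour v w) where

    private
      vw = proj₁ unique
      marked-vw = proj₁ (proj₂ unique)
      only-w = proj₂ (proj₂ unique)

    markedDegree-edge : ∀ a b → adj G a b ≡ true → markedDegree c ((a , b) ∷ []) v ≡ bit (isPair v w (a , b))
    markedDegree-edge a b ab with marked? c (a , b) | isPair v w (a , b) in pair
    ... | no ¬m | false = refl
    ... | no ¬m | true with isPair-true⁻ (a , b) pair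
    ...   | inj₁ refl = contradiction marked-vw ¬m
    ...   | inj₂ refl = contradiction (Marked-swap c {v} {w} marked-vw) ¬m
    markedDegree-edge a b ab | yes m | true with isPair-true⁻ (a , b) pair
    ...   | inj₁ refl = trans (occ-here v (w ∷ [])) (cong suc (occ-there [] (adj-irrefl vw)))
    ...   | inj₂ refl = trans (occ-there (v ∷ []) (adj-irrefl vw)) (occ-here v [])
    markedDegree-edge a b ab | yes m | false = All≢⇒occ≡0 v (a ∷ b ∷ []) (v≢a ∷ v≢b ∷ [])
      where
      v≢a : v ≢ a
      v≢a refl with only-w b ab m
      ... | refl with () ← trans (sym (isPair-refl v w)) pair
      v≢b : v ≢ b
      v≢b refl with only-w a (trans (Graph.sym G v a) ab) (Marked-swap c {a} {v} m)
      ... | refl with () ← trans (sym (isPair-swap v w)) pair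

    markedDegree-unique : ∀ s → EdgesOf G s → markedDegree c s v ≡ countB (isPair v w) s
    markedDegree-unique [] [] = refl
    markedDegree-unique ((a , b) ∷ s) (ab ∷ edges) = begin
      markedDegree c ((a , b) ∷ s) v                                    ≡⟨ markedDegree-∷ c (a , b) s v ⟩
      markedDegree c ((a , b) ∷ []) v + markedDegree c s v              ≡⟨ cong₂ _+_ (markedDegree-edge a b ab) (markedDegree-unique s edges) ⟩
      bit (isPair v w (a , b)) + countB (isPair v w) s                  ≡⟨ countB-∷ (isPair v w) (a , b) s ⟨
      countB (isPair v w) ((a , b) ∷ s)                                 ∎
      where open ≡-Reasoning

  markedDegree-unmatched : ∀ (v : Fin n) → matched c v ≡ false → ∀ s → markedDegree c s v ≡ 0
  markedDegree-unmatched v m [] = refl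
  markedDegree-unmatched v m ((a , b) ∷ s) =
    trans (markedDegree-∷ c (a , b) s v) (cong₂ _+_ edge (markedDegree-unmatched v m s))
    where
    edge : markedDegree c ((a , b) ∷ []) v ≡ 0
    edge with marked? c (a , b)
    ... | no _ = refl
    ... | yes (ma , mb , _) = All≢⇒occ≡0 v (a ∷ b ∷ []) (unmatched ma ∷ unmatched mb ∷ [])
      where
      unmatched : ∀ {x} → matched c x ≡ true → v ≢ x
      unmatched mx refl with () ← trans (sym mx) m

  Good : ℕ → Set
  Good k = (∀ v → matched c v ≡ true → ∃[ w ] UniqueMarkedNeighbour v w) × 2 * k ≤ matchedCount {n} c

  good? : ∀ k → Dec (Good k)
  good? k = all? (λ v → (matched c v Bool.≟ true) →-dec any? (uniqueMarkedNeighbour? v)) ×-dec (2 * k ≤? matchedCount {n} c)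

  markedDegree-good : ∀ {k} → Good k → ∀ s → ValidStream G s → ∀ v → markedDegree c s v ≡ bit (matched c v)
  markedDegree-good (neighbour , _) s (edges , once) v with matched c v in m
  ... | false = markedDegree-unmatched v m s
  ... | true with neighbour v m
  ...   | w , unique = trans (markedDegree-unique unique s edges) (once v w (proj₁ unique))

  tracks⇒accepts : ∀ {k} (st : State n) → Tracks st (λ v → bit (matched c v)) → 2 * k ≤ matchedCount {n} c → Accepts c k st
  tracks⇒accepts (once , twice) tracks 2k≤ = noTwice , covered , 2k≤
    where
    noTwice : ∀ v → lookup twice v ≡ false
    noTwice v with matched c v | tracks v
    ... | true | _ , t = t
    ... | false | _ , t = t
    covered : ∀ v → matched c v ≡ true → lookup once v ≡ true
    covered v m with tracks v
    ... | t , _ rewrite m = t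

completeness : ∀ n k (G : Graph n) c → Good G c k → ∀ s → ValidStream G s → run verifier n k c s ≡ true
completeness n k G c good s valid = trans (run-verifier n k c s) (dec-true (accepts? c k st) accepting)
  where
  st = foldl (process c) (initial n) s
  accepting : Accepts c k st
  accepting = tracks⇒accepts G c {k} st (Tracks-cong st (markedDegree-good G c {k} good s valid) (run-tracks c s)) (proj₂ good)

mate : ∀ {n} → List (Edge n) → Fin n → Fin n
mate [] v = v
mate ((a , b) ∷ M) v = if ⌊ a ≟ v ⌋ then b else if ⌊ b ≟ v ⌋ then a else mate M v

data MateSpec {n} (G : Graph n) (M : List (Edge n)) (v : Fin n) : Set where
  exposed : occ v (endpoints M) ≡ 0 → mate M v ≡ v → MateSpec G M v
  saturated : ∀ {w} → mate M v ≡ w → occ v (endpoints M) ≡ 1 → occ w (endpoints M) ≡ 1 →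
              w ≢ v → adj G v w ≡ true → mate M w ≡ v → MateSpec G M v

module _ {n} (G : Graph n) {a b : Fin n} {M : List (Edge n)}
         (ab : adj G a b ≡ true) (a≢b : a ≢ b) (a∉M : All (a ≢_) (endpoints M)) (b∉M : All (b ≢_) (endpoints M)) where

  private
    M′ = (a , b) ∷ M
    E = endpoints M
    E′ = endpoints M′
    b≢a : b ≢ a
    b≢a = a≢b ∘ sym

  mate-left : mate M′ a ≡ b
  mate-left with a ≟ a
  ... | yes _ = refl
  ... | no a≢a = contradiction refl a≢a

  mate-right : mate M′ b ≡ a
  mate-right with a ≟ b | b ≟ b
  ... | yes a≡b | _ = contradiction a≡b a≢b
  ... | no _ | yes _ = refl
  ... | no _ | no b≢b = contradiction refl b≢b

  mate-other : ∀ {v} → a ≢ v → b ≢ v → mate M′ v ≡ mate M v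
  mate-other {v} a≢v b≢v with a ≟ v | b ≟ v
  ... | yes a≡v | _ = contradiction a≡v a≢v
  ... | no _ | yes b≡v = contradiction b≡v b≢v
  ... | no _ | no _ = refl

  occ-left : occ a E′ ≡ 1
  occ-left = trans (occ-here a (b ∷ E)) (cong suc (trans (occ-there E b≢a) (All≢⇒occ≡0 a E a∉M)))

  occ-right : occ b E′ ≡ 1
  occ-right = trans (occ-there (b ∷ E) a≢b) (trans (occ-here b E) (cong suc (All≢⇒occ≡0 b E b∉M)))

  occ-other : ∀ {v} → a ≢ v → b ≢ v → occ v E′ ≡ occ v E
  occ-other a≢v b≢v = trans (occ-there (b ∷ E) a≢v) (occ-there E b≢v)

  spec-left : MateSpec G M′ a
  spec-left = saturated mate-left occ-left occ-right b≢a ab mate-right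

  spec-right : MateSpec G M′ b
  spec-right = saturated mate-right occ-right occ-left a≢b (trans (Graph.sym G b a) ab) mate-left

  spec-other : ∀ {v} → a ≢ v → b ≢ v → MateSpec G M v → MateSpec G M′ v
  spec-other a≢v b≢v (exposed o m) = exposed (trans (occ-other a≢v b≢v) o) (trans (mate-other a≢v b≢v) m)
  spec-other a≢v b≢v (saturated {w} m ov ow w≢v vw mw) =
    saturated (trans (mate-other a≢v b≢v) m) (trans (occ-other a≢v b≢v) ov) (trans (occ-other a≢w b≢w) ow)
      w≢v vw (trans (mate-other a≢w b≢w) mw)
    where
    a≢w : a ≢ w
    a≢w refl with () ← trans (sym ow) (All≢⇒occ≡0 a E a∉M)
    b≢w : b ≢ w
    b≢w refl with () ← trans (sym ow) (All≢⇒occ≡0 b E b∉M)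

mate-spec : ∀ {n} (G : Graph n) M → IsMatching G M → ∀ v → MateSpec G M v
mate-spec G [] _ v = exposed refl refl
mate-spec G ((a , b) ∷ M) (ab ∷ edges , (a≢b ∷ a∉M) ∷ (b∉M ∷ unique)) v with a ≟ v | b ≟ v
... | yes refl | _ = spec-left G ab a≢b a∉M b∉M
... | no _ | yes refl = spec-right G ab a≢b a∉M b∉M
... | no a≢v | no b≢v = spec-other G ab a≢b a∉M b∉M a≢v b≢v (mate-spec G M (edges , unique) v)

fresh : ∀ N (L : List ℕ) → length L ≤ N → ∃[ x ] x ≤ N × x ∉ L
fresh zero [] _ = 0 , z≤n , λ ()
fresh (suc N) L len with suc N ∈? L
... | no N+1∉L = suc N , ≤-refl , N+1∉L
... | yes N+1∈L with fresh N (filter (λ x → ¬? (x ℕ.≟ suc N)) L) (≤-pred (≤-trans shorter len))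
  where shorter = filter-notAll (λ x → ¬? (x ℕ.≟ suc N)) L (Any.map (λ N+1≡x x≢N+1 → x≢N+1 (sym N+1≡x)) N+1∈L)
...   | x , x≤N , x∉ = x , m≤n⇒m≤1+n x≤N , λ x∈L → x∉ (∈-filter⁺ (λ x → ¬? (x ℕ.≟ suc N)) x∈L (x≢N+1 x≤N))
  where
  x≢N+1 : ∀ {x} → x ≤ N → x ≢ suc N
  x≢N+1 x≤N refl = <⇒≱ (s≤s ≤-refl) x≤N

countB-∨ : ∀ {A : Set} (p r : A → Bool) xs → countB (λ x → p x ∨ r x) xs ≤ countB p xs + countB r xs
countB-∨ p r [] = z≤n
countB-∨ p r (x ∷ xs) with ih ← countB-∨ p r xs | p x | r x
... | true | true = s≤s (≤-trans ih (+-monoʳ-≤ (countB p xs) (n≤1+n _)))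
... | true | false = s≤s ih
... | false | true = ≤-trans (s≤s ih) (≤-reflexive (sym (+-suc _ _)))
... | false | false = ih

record PairColouring {n} (G : Graph n) (σ : Fin n → Fin n) (bound : ℕ) : Set where
  field
    colour     : Fin n → ℕ
    colour-σ   : ∀ v → colour (σ v) ≡ colour v
    proper     : ∀ {v w} → adj G v w ≡ true → w ≢ σ v → colour v ≢ colour w
    colour≤    : ∀ v → colour v ≤ bound

-- Greedy colouring of the graph in which each pair {v, σ v} is contracted to a single vertex.
module Greedy {n} (G : Graph n) (σ : Fin n → Fin n) (σ-involutive : ∀ v → σ (σ v) ≡ v)
              (D : ℕ) (deg≤D : ∀ v → deg G v ≤ D) where

  Partial : Set
  Partial = Fin n → Maybe ℕ

  coloursOn : (Fin n → Bool) → Partial → List (Fin n) → List ℕ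
  coloursOn q g [] = []
  coloursOn q g (w ∷ ws) with q w | g w
  ... | true | just x = x ∷ coloursOn q g ws
  ... | _ | _ = coloursOn q g ws

  length-coloursOn : ∀ q g ws → length (coloursOn q g ws) ≤ countB q ws
  length-coloursOn q g [] = z≤n
  length-coloursOn q g (w ∷ ws) with ih ← length-coloursOn q g ws | q w | g w
  ... | true | just _ = s≤s ih
  ... | true | nothing = m≤n⇒m≤1+n ih
  ... | false | _ = ih

  ∈-coloursOn : ∀ q g {w x} ws → w ∈ ws → q w ≡ true → g w ≡ just x → x ∈ coloursOn q g ws
  ∈-coloursOn q g (w ∷ ws) (here refl) qw gw rewrite qw | gw = here refl
  ∈-coloursOn q g (w′ ∷ ws) (there w∈ws) qw gw with q w′ | g w′
  ... | true | just _ = there (∈-coloursOn q g ws w∈ws qw gw)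
  ... | true | nothing = ∈-coloursOn q g ws w∈ws qw gw
  ... | false | _ = ∈-coloursOn q g ws w∈ws qw gw

  nearPair : Fin n → Fin n → Bool
  nearPair u w = adj G u w ∨ adj G (σ u) w

  forbidden : Partial → Fin n → List ℕ
  forbidden g u = coloursOn (nearPair u) g (allFin n)

  length-forbidden : ∀ g u → length (forbidden g u) ≤ D + D
  length-forbidden g u = ≤-trans (length-coloursOn (nearPair u) g (allFin n))
    (≤-trans (countB-∨ (adj G u) (adj G (σ u)) (allFin n)) (+-mono-≤ (deg≤D u) (deg≤D (σ u))))

  next : Partial → Fin n → ℕ
  next g u = proj₁ (fresh (D + D) (forbidden g u) (length-forbidden g u))

  next≤ : ∀ g u → next g u ≤ D + D
  next≤ g u = proj₁ (proj₂ (fresh (D + D) (forbidden g u) (length-forbidden g u)))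

  next∉ : ∀ g u → next g u ∉ forbidden g u
  next∉ g u = proj₂ (proj₂ (fresh (D + D) (forbidden g u) (length-forbidden g u)))

  InPair : Fin n → Fin n → Set
  InPair u v = v ≡ u ⊎ v ≡ σ u

  -- Opaque for the same reason as marked?.
  opaque
    inPair? : ∀ u v → Dec (InPair u v)
    inPair? u v = (v ≟ u) ⊎-dec (v ≟ σ u)

  assign : Partial → Fin n → Partial
  assign g u v = if does (inPair? u v) then just (next g u) else g v

  assign-in : ∀ g u {v} → InPair u v → assign g u v ≡ just (next g u)
  assign-in g u {v} v∈ with inPair? u v
  ... | yes _ = refl
  ... | no v∉ = contradiction v∈ v∉

  assign-out : ∀ g u {v} → ¬ InPair u v → assign g u v ≡ g v
  assign-out g u {v} v∉ with inPair? u v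
  ... | yes v∈ = contradiction v∈ v∉
  ... | no _ = refl

  record Valid (g : Partial) : Set where
    field
      σ-invariant : ∀ v → g (σ v) ≡ g v
      proper      : ∀ {v w x y} → adj G v w ≡ true → w ≢ σ v → g v ≡ just x → g w ≡ just y → x ≢ y
      bounded     : ∀ {v x} → g v ≡ just x → x ≤ D + D

  open Valid

  σ-injective : ∀ {v w} → σ v ≡ σ w → v ≡ w
  σ-injective {v} {w} eq = trans (sym (σ-involutive v)) (trans (cong σ eq) (σ-involutive w))

  σ-InPair : ∀ {u v} → InPair u v → InPair u (σ v)
  σ-InPair (inj₁ refl) = inj₂ refl
  σ-InPair (inj₂ refl) = inj₁ (σ-involutive _)

  σ-InPair⁻ : ∀ {u v} → InPair u (σ v) → InPair u v
  σ-InPair⁻ {u} {v} (inj₁ σv≡u) = inj₂ (trans (sym (σ-involutive v)) (cong σ σv≡u))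
  σ-InPair⁻ (inj₂ σv≡σu) = inj₁ (σ-injective σv≡σu)

  InPair-adj : ∀ {u v w} → InPair u v → InPair u w → adj G v w ≡ true → w ≡ σ v
  InPair-adj (inj₁ refl) (inj₁ refl) vw with () ← trans (sym vw) (irrefl G _)
  InPair-adj (inj₁ refl) (inj₂ refl) vw = refl
  InPair-adj (inj₂ refl) (inj₁ refl) vw = sym (σ-involutive _)
  InPair-adj (inj₂ refl) (inj₂ refl) vw with () ← trans (sym vw) (irrefl G _)

  ∈-forbidden : ∀ g {u v w y} → InPair u v → adj G v w ≡ true → g w ≡ just y → y ∈ forbidden g u
  ∈-forbidden g {w = w} v∈ vw gw = ∈-coloursOn _ g (allFin n) (∈-allFin w) (near v∈ vw) gw
    where
    near : ∀ {u v} → InPair u v → adj G v w ≡ true → nearPair u w ≡ true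
    near (inj₁ refl) vw rewrite vw = refl
    near {u} (inj₂ refl) vw rewrite vw = ∨-zeroʳ (adj G u w)

  valid-assign : ∀ {g} → Valid g → ∀ u → Valid (assign g u)
  σ-invariant (valid-assign {g} valid u) v with inPair? u v
  ... | yes v∈ = assign-in g u (σ-InPair v∈)
  ... | no v∉ = trans (assign-out g u (v∉ ∘ σ-InPair⁻)) (σ-invariant valid v)
  proper (valid-assign {g} valid u) {v} {w} vw w≢σv gv gw with inPair? u v | inPair? u w
  ... | yes v∈ | yes w∈ = contradiction (InPair-adj v∈ w∈ vw) w≢σv
  ... | yes v∈ | no w∉ = λ x≡y → next∉ g u (subst (_∈ forbidden g u) (sym (trans (just-injective gv) x≡y))
                                                 (∈-forbidden g v∈ vw gw))
  ... | no v∉ | yes w∈ = λ x≡y → next∉ g u (subst (_∈ forbidden g u) (trans x≡y (sym (just-injective gw)))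
                                                 (∈-forbidden g w∈ (trans (Graph.sym G w v) vw) gv))
  ... | no v∉ | no w∉ = proper valid vw w≢σv gv gw
  bounded (valid-assign {g} valid u) {v} gv with inPair? u v
  ... | yes v∈ = subst (_≤ D + D) (just-injective gv) (next≤ g u)
  ... | no v∉ = bounded valid gv

  extend : Partial → Fin n → Partial
  extend g u with g u
  ... | just _ = g
  ... | nothing = assign g u

  valid-extend : ∀ {g} → Valid g → ∀ u → Valid (extend g u)
  valid-extend {g} valid u with g u
  ... | just _ = valid
  ... | nothing = valid-assign valid u

  extend-mono : ∀ {g v x} → Valid g → ∀ u → g v ≡ just x → extend g u v ≡ just x
  extend-mono {g} {v} valid u gv with g u in gu
  ... | just _ = gv
  ... | nothing = trans (assign-out g u v∉) gv
    where
    v∉ : ¬ InPair u v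
    v∉ (inj₁ refl) with () ← trans (sym gu) gv
    v∉ (inj₂ refl) with () ← trans (sym gu) (trans (sym (σ-invariant valid u)) gv)

  extend-defined : ∀ g u → ∃[ x ] extend g u u ≡ just x
  extend-defined g u with g u in gu
  ... | just x = x , gu
  ... | nothing = next g u , assign-in g u (inj₁ refl)

  valid-foldl : ∀ {g} → Valid g → ∀ us → Valid (foldl extend g us)
  valid-foldl valid [] = valid
  valid-foldl valid (u ∷ us) = valid-foldl (valid-extend valid u) us

  foldl-mono : ∀ {g v x} → Valid g → ∀ us → g v ≡ just x → foldl extend g us v ≡ just x
  foldl-mono valid [] gv = gv
  foldl-mono valid (u ∷ us) gv = foldl-mono (valid-extend valid u) us (extend-mono valid u gv)

  foldl-defined : ∀ {g v} → Valid g → ∀ us → v ∈ us → ∃[ x ] foldl extend g us v ≡ just x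
  foldl-defined {g} valid (u ∷ us) (here refl) =
    proj₁ (extend-defined g u) , foldl-mono (valid-extend valid u) us (proj₂ (extend-defined g u))
  foldl-defined valid (u ∷ us) (there v∈us) = foldl-defined (valid-extend valid u) us v∈us

  empty-valid : Valid (λ _ → nothing)
  σ-invariant empty-valid v = refl
  proper empty-valid _ _ ()
  bounded empty-valid ()

  colouring : Partial
  colouring = foldl extend (λ _ → nothing) (allFin n)

  colouring-valid : Valid colouring
  colouring-valid = valid-foldl empty-valid (allFin n)

  colouring-defined : ∀ v → ∃[ x ] colouring v ≡ just x
  colouring-defined v = foldl-defined empty-valid (allFin n) (∈-allFin v)

  pairColouring : PairColouring G σ (D + D)
  pairColouring = record
    { colour = colour
    ; colour-σ = λ v → just-injective (trans (sym (colour-spec (σ v))) (trans (σ-invariant colouring-valid v) (colour-spec v)))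
    ; proper = λ vw w≢σv → proper colouring-valid vw w≢σv (colour-spec _) (colour-spec _)
    ; colour≤ = λ v → bounded colouring-valid (colour-spec v)
    }
    where
    colour : Fin n → ℕ
    colour v = proj₁ (colouring-defined v)
    colour-spec : ∀ v → colouring v ≡ just (colour v)
    colour-spec v = proj₂ (colouring-defined v)

deg≤maxDeg : ∀ {n} (G : Graph n) v → deg G v ≤ maxDeg G
deg≤maxDeg {n} G v = foldr-preservesᵒ (λ x y → [ flip ≤-trans (m≤m⊔n x y) , flip ≤-trans (m≤n⊔m x y) ]) 0
  (map (deg G) (allFin n)) (inj₂ (Any.map ≤-reflexive (∈-map⁺ (deg G) (∈-allFin v))))

labelWidth : ℕ → ℕ
labelWidth D = 2 + ⌈log₂ D ⌉

D+D<2^labelWidth : ∀ D → D + D < 2 ^ labelWidth D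
D+D<2^labelWidth D = begin-strict
  D + D         ≤⟨ +-mono-≤ (n≤2^⌈log₂n⌉ D) (n≤2^⌈log₂n⌉ D) ⟩
  P + P         ≡⟨ cong (P +_) (+-identityʳ P) ⟨
  2 * P         <⟨ *-monoʳ-< 2 (m<m+n P (subst (0 <_) (sym (+-identityʳ P)) (m^n>0 2 ⌈log₂ D ⌉))) ⟩
  2 * (2 * P)   ∎
  where
  open ≤-Reasoning
  P = 2 ^ ⌈log₂ D ⌉

certificateLength : ∀ {n} → Graph n → ℕ
certificateLength {n} G = suc n * suc (labelWidth (maxDeg G))

module _ {n} (G : Graph n) {k : ℕ} {M : List (Edge n)} (matching : IsMatching G M) (k≤|M| : k ≤ length M) where

  private
    σ = mate M
    spec = mate-spec G M matching
    W = labelWidth (maxDeg G)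

    σ-involutive : ∀ v → σ (σ v) ≡ v
    σ-involutive v with spec v
    ... | exposed _ σv≡v = trans (cong σ σv≡v) σv≡v
    ... | saturated refl _ _ _ _ σσv≡v = σσv≡v

    open PairColouring (Greedy.pairColouring G σ σ-involutive (maxDeg G) (deg≤maxDeg G))

    isMatched : Fin n → Bool
    isMatched v = not ⌊ σ v ≟ v ⌋

    blocks : Fin n → List Bool
    blocks v = isMatched v ∷ bits W (colour v)

    length-blocks : ∀ v → length (blocks v) ≡ suc W
    length-blocks v = cong suc (length-bits W (colour v))

    isMatched-fixed : ∀ {v} → σ v ≡ v → isMatched v ≡ false
    isMatched-fixed {v} σv≡v with σ v ≟ v
    ... | yes _ = refl
    ... | no σv≢v = contradiction σv≡v σv≢v

    isMatched-moved : ∀ {v} → σ v ≢ v → isMatched v ≡ true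
    isMatched-moved {v} σv≢v with σ v ≟ v
    ... | yes σv≡v = contradiction σv≡v σv≢v
    ... | no _ = refl

  certificate : Certificate
  certificate = encode W n blocks

  length-certificate : length certificate ≡ certificateLength G
  length-certificate = length-encode blocks length-blocks

  private
    matched-certificate : ∀ v → matched certificate v ≡ isMatched v
    matched-certificate v = cong headBit (block-encode blocks length-blocks v)

    label-certificate : ∀ v → label certificate v ≡ bits W (colour v)
    label-certificate v = cong (drop 1) (block-encode blocks length-blocks v)

    colour< : ∀ v → colour v < 2 ^ W
    colour< v = ≤-<-trans (colour≤ v) (D+D<2^labelWidth (maxDeg G))

    marked⇒same-colour : ∀ {v w} → Marked certificate (v , w) → colour v ≡ colour w
    marked⇒same-colour {v} {w} (_ , _ , same-label) = bits-injective W (colour< v) (colour< w)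
      (trans (sym (label-certificate v)) (trans same-label (label-certificate w)))

    bit-matched≡occ : ∀ v → bit (matched certificate v) ≡ occ v (endpoints M)
    bit-matched≡occ v rewrite matched-certificate v with spec v
    ... | exposed occ≡0 σv≡v rewrite isMatched-fixed σv≡v = sym occ≡0
    ... | saturated refl occ≡1 _ σv≢v _ _ rewrite isMatched-moved σv≢v = sym occ≡1

    uniqueMarkedNeighbour : ∀ v → matched certificate v ≡ true → UniqueMarkedNeighbour G certificate v (σ v)
    uniqueMarkedNeighbour v m with spec v
    ... | exposed _ σv≡v with () ← trans (sym m) (trans (matched-certificate v) (isMatched-fixed σv≡v))
    ... | saturated refl _ _ σv≢v adjacent σσv≡v = adjacent , marked-mate , only-mate
      where
      marked-mate : Marked certificate (v , σ v)
      marked-mate = m , trans (matched-certificate (σ v)) (isMatched-moved (λ σσv≡σv → σv≢v (sym (trans (sym σσv≡v) σσv≡σv)))) ,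
                    trans (label-certificate v) (trans (cong (bits W) (sym (colour-σ v))) (sym (label-certificate (σ v))))
      only-mate : ∀ u → adj G v u ≡ true → Marked certificate (v , u) → u ≡ σ v
      only-mate u vu marked with u ≟ σ v
      ... | yes u≡σv = u≡σv
      ... | no u≢σv = contradiction (marked⇒same-colour marked) (proper vu u≢σv)

  certificate-good : Good G certificate k
  certificate-good = (λ v m → σ v , uniqueMarkedNeighbour v m) , (begin
    2 * k                                     ≤⟨ *-monoʳ-≤ 2 k≤|M| ⟩
    2 * length M                              ≡⟨ length-endpoints M ⟨
    length (endpoints M)                      ≡⟨ sum-occ (endpoints M) ⟨
    sum (λ v → occ v (endpoints M))           ≡⟨ sum-cong-≗ bit-matched≡occ ⟨
    matchedCount {n} certificate              ∎)
    where open ≤-Reasoning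

searchLists : ∀ m {P : List Bool → Set} → Decidable P → Dec (∃[ xs ] length xs ≡ m × P xs)
searchLists zero P? = map′ (λ p → [] , refl , p) (λ { ([] , _ , p) → p }) (P? [])
searchLists (suc m) {P} P? =
  map′ cons uncons (searchLists m (P? ∘ (false ∷_)) ⊎-dec searchLists m (P? ∘ (true ∷_)))
  where
  Extends : Bool → Set
  Extends b = ∃[ xs ] length xs ≡ m × P (b ∷ xs)
  cons : Extends false ⊎ Extends true → ∃[ xs ] length xs ≡ suc m × P xs
  cons (inj₁ (xs , len , p)) = false ∷ xs , cong suc len , p
  cons (inj₂ (xs , len , p)) = true ∷ xs , cong suc len , p
  uncons : ∃[ xs ] length xs ≡ suc m × P xs → Extends false ⊎ Extends true
  uncons (false ∷ xs , len , p) = inj₁ (xs , suc-injective len , p)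
  uncons (true ∷ xs , len , p) = inj₂ (xs , suc-injective len , p)

prover : Prover
prover n k G with searchLists (certificateLength G) (λ c → good? G c k)
... | yes (c , _) = c
... | no _ = []

prover-good : ∀ n k (G : Graph n) → MaxMatchingGE G k → length (prover n k G) ≡ certificateLength G × Good G (prover n k G) k
prover-good n k G (M , matching , k≤|M|) with searchLists (certificateLength G) (λ c → good? G c k)
... | yes (_ , len , good) = len , good
... | no none = contradiction (certificate G matching k≤|M| , length-certificate G matching k≤|M| , certificate-good G matching k≤|M|) none

suc[n]*[3+L]≤8*n*L : ∀ n L → 1 ≤ n → 1 ≤ L → suc n * (3 + L) ≤ 8 * n * L
suc[n]*[3+L]≤8*n*L n L 1≤n 1≤L = begin
  suc n * (3 + L)     ≤⟨ *-mono-≤ (+-mono-≤ 1≤n (m≤m+n n 0)) (+-monoˡ-≤ L (*-monoʳ-≤ 3 1≤L)) ⟩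
  (2 * n) * (3 * L + L) ≡⟨ regroup n L ⟩
  8 * n * L           ∎
  where
  open ≤-Reasoning
  regroup : ∀ n L → (2 * n) * (3 * L + L) ≡ 8 * n * L
  regroup = solve-∀

certificateLength≤ : ∀ {n} (G : Graph n) → 2 ≤ maxDeg G → certificateLength G ≤ 8 * n * ⌈log₂ (maxDeg G) ⌉
certificateLength≤ {zero} G ()
certificateLength≤ {suc n} G 2≤Δ = suc[n]*[3+L]≤8*n*L (suc n) ⌈log₂ (maxDeg G) ⌉ (s≤s z≤n) (⌈log₂⌉-mono-≤ 2≤Δ)

lemma5 : Σ Verifier λ V → Σ Prover λ P → Σ ℕ λ C →
    (∀ n k (G : Graph n) → MaxMatchingGE G k →
       ∀ s → ValidStream G s → run V n k (P n k G) s ≡ true) ×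
    (∀ n k (G : Graph n) → ¬ MaxMatchingGE G k →
       ∀ (c : Certificate) s → ValidStream G s → run V n k c s ≡ false) ×
    (∀ n k (G : Graph n) → MaxMatchingGE G k → 2 ≤ maxDeg G →
       length (P n k G) ≤ C * n * ⌈log₂ (maxDeg G) ⌉) ×
    (∀ n → space V n ≤ C * n)
lemma5 = verifier , prover , 8 , complete , sound , size , space-bound
  where
  complete : ∀ n k (G : Graph n) → MaxMatchingGE G k → ∀ s → ValidStream G s → run verifier n k (prover n k G) s ≡ true
  complete n k G matching = completeness n k G _ (proj₂ (prover-good n k G matching))
  sound : ∀ n k (G : Graph n) → ¬ MaxMatchingGE G k → ∀ c s → ValidStream G s → run verifier n k c s ≡ false
  sound n k G none c s valid with run verifier n k c s in accepted
  ... | true = contradiction (soundness n k G c s valid accepted) none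
  ... | false = refl
  size : ∀ n k (G : Graph n) → MaxMatchingGE G k → 2 ≤ maxDeg G → length (prover n k G) ≤ 8 * n * ⌈log₂ (maxDeg G) ⌉
  size n k G matching 2≤Δ = ≤-trans (≤-reflexive (proj₁ (prover-good n k G matching))) (certificateLength≤ G 2≤Δ)
  space-bound : ∀ n → space verifier n ≤ 8 * n
  space-bound n = +-monoʳ-≤ n (m≤m+n n _)
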